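{- Let $p \geq 5$ be a prime and let $C_n = \frac{1}{n+1}\binom{2n}{n}$ denote the $n$th Catalan number. Then for every residue $r \in \mathbb{Z}/p\mathbb{Z}$ there exists $n \in \mathbb{N}$ with $C_n \equiv r \pmod p$. -}

module Defs where

open import Data.Nat using (ℕ; suc; _*_; _/_)
open import Data.Nat.Combinatorics using (_C_)

-- The n-th Catalan number C_n = (1/(n+1)) * binom(2n, n).
-- (n+1) always divides binom(2n,n), so this natural-number division is exact.
catalan : ℕ → ℕ
catalan n = ((2 * n) C n) / suc n

module Submission where

-- Write B(k) = C(2k,k) for the central binomial coefficient, so that
-- (n+1)·Cat(n) = B(n).
--  * Lucas's theorem for one p-adic digit gives, for 2c < p,
--    B(c + M·p) ≡ B(c)·B(M); together with (1 + M·p) ≡ 1 this yields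
--    Cat(M·p) ≡ B(M).  Hence it suffices to show that every nonzero
--    residue is a value of B, and the set of such values is closed under
--    multiplication by every "small" B(c) with 2c < p.
--  * The small B(c) are units, so a product of them has an inverse which
--    is a power of it (pigeonhole).  Since B(1) = 2 and
--    (j+1)·B(j+1) = (2j+1)·2·B(j), strong induction on m shows that every
--    1 ≤ m < p is a value of B: even m = 2·(m/2), odd m = 2j+1 from j+1.
--  * The residue 0: for p = a + 4, Lucas gives B(a+2) ≡ C(a,a+2)·C(1,0) = 0,
--    and a+3 < p is a unit, so p divides Cat(a+2).

open import Defs
open import Data.Nat using (ℕ; _≤_; _%_; NonZero)
open import Data.Nat.Primality using (Prime)
open import Data.Fin using (Fin; toℕ)
open import Data.Product using (∃-syntax)
open import Relation.Binary.PropositionalEquality using (_≡_)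

open import Level using (0ℓ)
open import Data.Nat
open import Data.Nat.Properties
open import Data.Nat.Combinatorics using (_C_; nCk+nC[k+1]≡[n+1]C[k+1]; nCk≡nC[n∸k])
open import Data.Nat.DivMod
open import Data.Nat.Divisibility
open import Data.Nat.Induction using (<-rec)
open import Data.Nat.Primality using (euclidsLemma; ¬prime[1]; prime⇒¬composite; composite)
open import Data.Nat.Tactic.RingSolver using (solve-∀)
open import Data.Fin using (fromℕ<)
open import Data.Fin.Properties using (pigeonhole; toℕ-fromℕ<; toℕ<n)
open import Data.Product using (_,_)
open import Data.Sum using ([_,_]′)
open import Relation.Binary.Bundles using (Setoid)
open import Relation.Binary.Structures using (IsEquivalence)
import Relation.Binary.Reasoning.Setoid as SetoidReasoning
open import Relation.Binary.PropositionalEquality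
  using (_≢_; refl; sym; trans; cong; cong₂; subst; module ≡-Reasoning)
open import Relation.Nullary using (contradiction)

double-suc : ∀ k → 2 * suc k ≡ suc (suc (2 * k))
double-suc = solve-∀

odd-as-sum : ∀ k → suc (2 * k) ≡ k + suc k
odd-as-sum = solve-∀

odd-times : ∀ n b → suc (2 * n) * b ≡ suc n * b + n * b
odd-times = solve-∀

even-times : ∀ k b → suc (suc (2 * k)) * b ≡ 2 * (suc k * b)
even-times = solve-∀

double-inside : ∀ m b → 2 * (m * b) ≡ m * (2 * b)
double-inside = solve-∀

double-digits : ∀ c M p → 2 * (c + M * p) ≡ 2 * c + 2 * M * p
double-digits = solve-∀

double-offset : ∀ a → 2 * (2 + a) ≡ a + 1 * (4 + a)
double-offset = solve-∀

rotate : ∀ a b c → a * b * c ≡ c * a * b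
rotate = solve-∀

-- Binomial coefficients defined by Pascal's rule, so that they compute by
-- recursion; they agree with the library's n C k.
binom : ℕ → ℕ → ℕ
binom n       zero    = 1
binom zero    (suc k) = 0
binom (suc n) (suc k) = binom n k + binom n (suc k)

C≡binom : ∀ n k → n C k ≡ binom n k
C≡binom n       zero    = refl
C≡binom zero    (suc k) = refl
C≡binom (suc n) (suc k) =
  trans (sym (nCk+nC[k+1]≡[n+1]C[k+1] n k)) (cong₂ _+_ (C≡binom n k) (C≡binom n (suc k)))

binom-vanish : ∀ n k → n < k → binom n k ≡ 0
binom-vanish zero    (suc k) _         = refl
binom-vanish (suc n) (suc k) (s≤s n<k) =
  cong₂ _+_ (binom-vanish n k n<k) (binom-vanish n (suc k) (m<n⇒m<1+n n<k))

binom-diag : ∀ n → binom n n ≡ 1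
binom-diag zero    = refl
binom-diag (suc n) = cong₂ _+_ (binom-diag n) (binom-vanish n (suc n) ≤-refl)

binom-one : ∀ n → binom n 1 ≡ n
binom-one zero    = refl
binom-one (suc n) = cong suc (binom-one n)

absorption : ∀ m k → suc k * binom (suc m) (suc k) ≡ suc m * binom m k
absorption m       zero    =
  trans (*-identityˡ _) (trans (binom-one (suc m)) (sym (*-identityʳ (suc m))))
absorption zero    (suc k) = *-zeroʳ (suc (suc k))
absorption (suc m) (suc k) = begin
  suc (suc k) * (X + Y)                            ≡⟨ *-distribˡ-+ (suc (suc k)) X Y ⟩
  X + suc k * X + suc (suc k) * Y                  ≡⟨ cong₂ (λ a b → X + a + b) (absorption m k) (absorption m (suc k)) ⟩
  X + suc m * binom m k + suc m * binom m (suc k)  ≡⟨ +-assoc X _ _ ⟩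
  X + (suc m * binom m k + suc m * binom m (suc k)) ≡⟨ cong (X +_) (*-distribˡ-+ (suc m) (binom m k) (binom m (suc k))) ⟨
  X + suc m * X                                    ∎
  where
  open ≡-Reasoning
  X = binom (suc m) (suc k)
  Y = binom (suc m) (suc (suc k))

split-absorption : ∀ m k → suc k * binom m k + suc k * binom m (suc k) ≡ suc m * binom m k
split-absorption m k = trans (sym (*-distribˡ-+ (suc k) (binom m k) _)) (absorption m k)

central : ℕ → ℕ
central k = binom (2 * k) k

central-neighbour : ∀ n → suc n * binom (2 * n) (suc n) ≡ n * central n
central-neighbour n = +-cancelˡ-≡ (suc n * central n) _ _
  (trans (split-absorption (2 * n) n) (odd-times n (central n)))

central-quotient : ∀ n → suc n * (central n ∸ binom (2 * n) (suc n)) ≡ central n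
central-quotient n = begin
  suc n * (B ∸ binom (2 * n) (suc n))          ≡⟨ *-distribˡ-∸ (suc n) B (binom (2 * n) (suc n)) ⟩
  suc n * B ∸ suc n * binom (2 * n) (suc n)    ≡⟨ cong (suc n * B ∸_) (central-neighbour n) ⟩
  B + n * B ∸ n * B                            ≡⟨ m+n∸n≡m B (n * B) ⟩
  B                                            ∎
  where
  open ≡-Reasoning
  B = central n

catalan-spec : ∀ n → suc n * catalan n ≡ central n
catalan-spec n = begin
  suc n * catalan n            ≡⟨ cong (λ t → suc n * (t / suc n)) (C≡binom (2 * n) n) ⟩
  suc n * (central n / suc n)  ≡⟨ m*[n/m]≡n (divides D (sym (trans (*-comm D (suc n)) (central-quotient n)))) ⟩
  central n                    ∎
  where
  open ≡-Reasoning
  D = central n ∸ binom (2 * n) (suc n)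

middle-symmetry : ∀ k → binom (suc (2 * k)) k ≡ binom (suc (2 * k)) (suc k)
middle-symmetry k = begin
  binom (suc (2 * k)) k            ≡⟨ C≡binom _ k ⟨
  suc (2 * k) C k                  ≡⟨ nCk≡nC[n∸k] (≤-trans (m≤m+n k (k + 0)) (n≤1+n _)) ⟩
  suc (2 * k) C (suc (2 * k) ∸ k)  ≡⟨ cong (λ t → suc (2 * k) C (t ∸ k)) (odd-as-sum k) ⟩
  suc (2 * k) C (k + suc k ∸ k)    ≡⟨ cong (suc (2 * k) C_) (m+n∸m≡n k (suc k)) ⟩
  suc (2 * k) C suc k              ≡⟨ C≡binom _ (suc k) ⟩
  binom (suc (2 * k)) (suc k)      ∎
  where open ≡-Reasoning

central-ratio : ∀ k → suc k * central (suc k) ≡ suc (2 * k) * (2 * central k)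
central-ratio k = begin
  suc k * binom (2 * suc k) (suc k)                ≡⟨ cong (λ t → suc k * binom t (suc k)) (double-suc k) ⟩
  suc k * binom (suc (suc (2 * k))) (suc k)        ≡⟨ absorption (suc (2 * k)) k ⟩
  suc (suc (2 * k)) * binom (suc (2 * k)) k        ≡⟨ cong (suc (suc (2 * k)) *_) (middle-symmetry k) ⟩
  suc (suc (2 * k)) * binom (suc (2 * k)) (suc k)  ≡⟨ even-times k (binom (suc (2 * k)) (suc k)) ⟩
  2 * (suc k * binom (suc (2 * k)) (suc k))        ≡⟨ cong (2 *_) (absorption (2 * k) k) ⟩
  2 * (suc (2 * k) * central k)                    ≡⟨ double-inside (suc (2 * k)) (central k) ⟩
  suc (2 * k) * (2 * central k)                    ∎
  where open ≡-Reasoning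

data EvenOdd : ℕ → Set where
  even : ∀ j → EvenOdd (2 * j)
  odd  : ∀ j → EvenOdd (suc (2 * j))

evenOdd : ∀ m → EvenOdd m
evenOdd zero    = even 0
evenOdd (suc m) with evenOdd m
... | even j = odd j
... | odd j  = subst EvenOdd (double-suc j) (even (suc j))

module Congruence (p : ℕ) .{{_ : NonZero p}} where

  infix 4 _≋_
  record _≋_ (a b : ℕ) : Set where
    constructor mk≋
    field same-residue : a % p ≡ b % p
  open _≋_ public

  ≋-isEquivalence : IsEquivalence _≋_
  ≋-isEquivalence = record
    { refl  = mk≋ refl
    ; sym   = λ e → mk≋ (sym (same-residue e))
    ; trans = λ e f → mk≋ (trans (same-residue e) (same-residue f))
    }

  open IsEquivalence ≋-isEquivalence public
    using () renaming (refl to ≋-refl; sym to ≋-sym; trans to ≋-trans; reflexive to ≋-reflexive)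

  ≋-setoid : Setoid 0ℓ 0ℓ
  ≋-setoid = record { isEquivalence = ≋-isEquivalence }

  module ≋-Reasoning = SetoidReasoning ≋-setoid

  +-≋ : ∀ {a b c d} → a ≋ b → c ≋ d → a + c ≋ b + d
  +-≋ {a} {b} {c} {d} (mk≋ e) (mk≋ f) = mk≋ (begin
    (a + c) % p              ≡⟨ %-distribˡ-+ a c p ⟩
    (a % p + c % p) % p      ≡⟨ cong₂ (λ x y → (x + y) % p) e f ⟩
    (b % p + d % p) % p      ≡⟨ %-distribˡ-+ b d p ⟨
    (b + d) % p              ∎)
    where open ≡-Reasoning

  *-≋ : ∀ {a b c d} → a ≋ b → c ≋ d → a * c ≋ b * d
  *-≋ {a} {b} {c} {d} (mk≋ e) (mk≋ f) = mk≋ (begin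
    (a * c) % p              ≡⟨ %-distribˡ-* a c p ⟩
    (a % p * (c % p)) % p    ≡⟨ cong₂ (λ x y → (x * y) % p) e f ⟩
    (b % p * (d % p)) % p    ≡⟨ %-distribˡ-* b d p ⟨
    (b * d) % p              ∎)
    where open ≡-Reasoning

  add-multiple : ∀ a k → a + k * p ≋ a
  add-multiple a k = mk≋ ([m+kn]%n≡m%n a k p)

  ≋⇒∣∸ : ∀ {a b} → a ≋ b → p ∣ b ∸ a
  ≋⇒∣∸ {a} {b} (mk≋ e) = divides (b / p ∸ a / p) (begin
    b ∸ a                                          ≡⟨ cong₂ _∸_ (m≡m%n+[m/n]*n b p) (m≡m%n+[m/n]*n a p) ⟩
    (b % p + b / p * p) ∸ (a % p + a / p * p)      ≡⟨ cong (λ r → (r + b / p * p) ∸ (a % p + a / p * p)) (sym e) ⟩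
    (a % p + b / p * p) ∸ (a % p + a / p * p)      ≡⟨ [m+n]∸[m+o]≡n∸o (a % p) _ _ ⟩
    b / p * p ∸ a / p * p                          ≡⟨ *-distribʳ-∸ p (b / p) (a / p) ⟨
    (b / p ∸ a / p) * p                            ∎)
    where open ≡-Reasoning

  ∣∸⇒≋ : ∀ {a b} → a ≤ b → p ∣ b ∸ a → a ≋ b
  ∣∸⇒≋ {a} {b} a≤b p∣b∸a = mk≋ (begin
    a % p             ≡⟨ %-remove-+ʳ a p∣b∸a ⟨
    (a + (b ∸ a)) % p ≡⟨ cong (_% p) (m+[n∸m]≡n a≤b) ⟩
    b % p             ∎)
    where open ≡-Reasoning

  ≋0⇒∣ : ∀ {a} → a ≋ 0 → p ∣ a
  ≋0⇒∣ e = ≋⇒∣∸ (≋-sym e)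

  ∤-small : ∀ {a} → 0 < a → a < p → p ∤ a
  ∤-small {suc a} _ a<p p∣a = <⇒≱ a<p (∣⇒≤ p∣a)

  residue : ℕ → Fin p
  residue a = fromℕ< (m%n<n a p)

  residue-≋ : ∀ {a b} → residue a ≡ residue b → a ≋ b
  residue-≋ {a} {b} e = mk≋ (begin
    a % p                ≡⟨ toℕ-fromℕ< (m%n<n a p) ⟨
    toℕ (residue a)      ≡⟨ cong toℕ e ⟩
    toℕ (residue b)      ≡⟨ toℕ-fromℕ< (m%n<n b p) ⟩
    b % p                ∎)
    where open ≡-Reasoning

  module Units (p-prime : Prime p) where

    ∣-resolve : ∀ {c x} → p ∤ c → p ∣ c * x → p ∣ x
    ∣-resolve {c} {x} p∤c p∣cx = [ (λ p∣c → contradiction p∣c p∤c) , (λ p∣x → p∣x) ]′ (euclidsLemma c x p-prime p∣cx)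

    ∤-* : ∀ {a b} → p ∤ a → p ∤ b → p ∤ a * b
    ∤-* p∤a p∤b p∣ab = p∤b (∣-resolve p∤a p∣ab)

    p∤1 : p ∤ 1
    p∤1 p∣1 = ¬prime[1] (subst Prime (∣1⇒≡1 p∣1) p-prime)

    ∤-^ : ∀ {a} → p ∤ a → ∀ n → p ∤ a ^ n
    ∤-^ p∤a zero    = p∤1
    ∤-^ p∤a (suc n) = ∤-* p∤a (∤-^ p∤a n)

    *-cancelˡ-≋ : ∀ {c a b} → p ∤ c → c * a ≋ c * b → a ≋ b
    *-cancelˡ-≋ {c} {a} {b} p∤c e =
      [ (λ a≤b → cancel a≤b e) , (λ b≤a → ≋-sym (cancel b≤a (≋-sym e))) ]′ (≤-total a b)
      where
      cancel : ∀ {x y} → x ≤ y → c * x ≋ c * y → x ≋ y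
      cancel {x} {y} x≤y cx≋cy =
        ∣∸⇒≋ x≤y (∣-resolve p∤c (subst (p ∣_) (sym (*-distribˡ-∸ c y x)) (≋⇒∣∸ cx≋cy)))

    -- Every unit x has an inverse of the form x^k: two of the powers
    -- x^0, …, x^p share a residue, and cancelling gives x·x^k ≡ 1.
    power-inverse : ∀ {x} → p ∤ x → ∃[ k ] x * x ^ k ≋ 1
    power-inverse {x} p∤x with pigeonhole (n<1+n p) (λ i → residue (x ^ toℕ i))
    ... | i , j , i<j , same-residues = k , ≋-sym (*-cancelˡ-≋ (∤-^ p∤x (toℕ i)) (begin
      x ^ toℕ i * 1               ≡⟨ *-identityʳ _ ⟩
      x ^ toℕ i                   ≈⟨ residue-≋ same-residues ⟩
      x ^ toℕ j                   ≡⟨ cong (x ^_) j≡i+1+k ⟨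
      x ^ (toℕ i + suc k)         ≡⟨ ^-distribˡ-+-* x (toℕ i) (suc k) ⟩
      x ^ toℕ i * (x * x ^ k)     ∎))
      where
      open ≋-Reasoning
      k = toℕ j ∸ suc (toℕ i)
      j≡i+1+k : toℕ i + suc k ≡ toℕ j
      j≡i+1+k = trans (+-suc (toℕ i) k) (m+[n∸m]≡n i<j)

-- Catalan numbers modulo a prime p, written p = q + 1 so that Pascal's
-- rule computes at p.
module CatalanModPrime (q : ℕ) (p-prime : Prime (suc q)) where

  p : ℕ
  p = suc q

  open Congruence p
  open Units p-prime

  prime∣binom : ∀ j → suc j < p → p ∣ binom p (suc j)
  prime∣binom j j<p =
    ∣-resolve (∤-small z<s j<p) (subst (p ∣_) (sym (absorption q j)) (m∣m*n (binom q j)))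

  -- Lucas's theorem for one p-adic digit:
  -- C(a + A·p, b + B·p) ≡ C(a,b)·C(A,B) when a, b < p.
  -- Induction on (A, a) along Pascal's rule; carries into the digit A
  -- produce the factor C(p, b+1) ≡ 0.
  lucas : ∀ A a B b → a < p → b < p → binom (a + A * p) (b + B * p) ≋ binom a b * binom A B
  lucas A a       zero    zero    _   _   = ≋-refl
  -- b = 0 borrows from B; the borrowed term C(a, q)·C(A,B) vanishes as a < q.
  lucas A (suc a) (suc B) zero    a<p b<p =
    ≋-trans (+-≋ (lucas A a B q a<p′ ≤-refl) (lucas A a (suc B) zero a<p′ b<p))
      (≋-reflexive (cong (λ t → t * binom A B + binom a 0 * binom A (suc B)) (binom-vanish a q (≤-pred a<p))))
    where a<p′ = <-trans (n<1+n a) a<p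
  -- Pascal's rule in the lower digit.
  lucas A (suc a) B       (suc b) a<p b<p =
    ≋-trans (+-≋ (lucas A a B b a<p′ (<-trans (n<1+n b) b<p)) (lucas A a B (suc b) a<p′ b<p))
      (≋-reflexive (sym (*-distribʳ-+ (binom A B) (binom a b) (binom a (suc b)))))
    where a<p′ = <-trans (n<1+n a) a<p
  lucas zero    zero    B       (suc b) _   _   = ≋-refl
  lucas zero    zero    (suc B) zero    _   _   = ≋-refl
  -- a = 0 borrows from A and b = 0 from B; Pascal's rule in the upper digits.
  lucas (suc A) zero    (suc B) zero    _   b<p =
    ≋-trans (+-≋ (lucas A q B q ≤-refl ≤-refl) (lucas A q (suc B) zero ≤-refl b<p))
      (≋-reflexive (trans (cong (λ t → t * binom A B + 1 * binom A (suc B)) (binom-diag q))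
                          (sym (*-distribˡ-+ 1 (binom A B) (binom A (suc B))))))
  -- a = 0 borrows from A: the sum collects to C(p, b+1)·C(A,B) ≡ 0.
  lucas (suc A) zero    B       (suc b) _   b<p =
    ≋-trans (+-≋ (lucas A q B b ≤-refl (<-trans (n<1+n b) b<p)) (lucas A q B (suc b) ≤-refl b<p))
      (≋-trans (≋-reflexive (sym (*-distribʳ-+ (binom A B) (binom q b) (binom q (suc b)))))
               (*-≋ {binom p (suc b)} {0} (mk≋ (n∣m⇒m%n≡0 (binom p (suc b)) p (prime∣binom b b<p))) (≋-refl {binom A B})))

  central-lucas : ∀ c M → 2 * c < p → central (c + M * p) ≋ central c * central M
  central-lucas c M 2c<p =
    subst (λ t → binom t (c + M * p) ≋ central c * central M) (sym (double-digits c M p))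
      (lucas (2 * M) (2 * c) M c 2c<p (≤-<-trans (m≤m+n c (c + 0)) 2c<p))

  binom-unit : ∀ n k → n < p → k ≤ n → p ∤ binom n k
  binom-unit n       zero    _   _         = p∤1
  binom-unit (suc n) (suc k) n<p (s≤s k≤n) p∣binom =
    binom-unit n k (<-trans (n<1+n n) n<p) k≤n
      (∣-resolve (∤-small z<s n<p) (subst (p ∣_) (absorption n k) (∣n⇒∣m*n (suc k) p∣binom)))

  central-unit : ∀ k → 2 * k < p → p ∤ central k
  central-unit k 2k<p = binom-unit (2 * k) k 2k<p (m≤m+n k (k + 0))

  -- An odd prime is not even, so an odd number below it is followed by
  -- an even number still below it.
  odd-bound : 2 < p → ∀ j → suc (2 * j) < p → 2 * suc j < p
  odd-bound 2<p j 2j+1<p = ≤∧≢⇒< (subst (_≤ p) (sym (double-suc j)) 2j+1<p) p-even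
    where
    p-even : 2 * suc j ≢ p
    p-even eq = prime⇒¬composite p-prime (composite 2<p (divides (suc j) (trans (sym eq) (*-comm 2 (suc j)))))

  -- Cat(M·p) ≡ B(M): multiply (1 + M·p)·Cat(M·p) = B(M·p) and use Lucas.
  catalan-at-multiple : ∀ M → catalan (M * p) ≋ central M
  catalan-at-multiple M = begin
    catalan n             ≡⟨ *-identityˡ (catalan n) ⟨
    1 * catalan n         ≈⟨ *-≋ (≋-sym (add-multiple 1 M)) ≋-refl ⟩
    suc n * catalan n     ≡⟨ catalan-spec n ⟩
    central (0 + M * p)   ≈⟨ central-lucas 0 M z<s ⟩
    1 * central M         ≡⟨ *-identityˡ (central M) ⟩
    central M             ∎
    where
    open ≋-Reasoning
    n = M * p

  -- For p = a + 4, p divides Cat(a+2): by Lucas B(a+2) ≡ C(a,a+2)·C(1,0) = 0,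
  -- and the factor a+3 < p is a unit.
  catalan-vanishes : ∀ a → p ≡ 4 + a → p ∣ catalan (2 + a)
  catalan-vanishes a p≡4+a =
    ∣-resolve (∤-small z<s (below-p ≤-refl)) (subst (p ∣_) (sym (catalan-spec n)) (≋0⇒∣ central≋0))
    where
    open ≋-Reasoning
    n = 2 + a
    below-p : ∀ {m} → m < 4 + a → m < p
    below-p {m} m<4+a = subst (m <_) (sym p≡4+a) m<4+a
    digits : 2 * n ≡ a + 1 * p
    digits = trans (double-offset a) (cong (λ t → a + 1 * t) (sym p≡4+a))
    central≋0 : central n ≋ 0
    central≋0 = begin
      central n                      ≡⟨ cong₂ binom digits (sym (+-identityʳ n)) ⟩
      binom (a + 1 * p) (n + 0 * p)  ≈⟨ lucas 1 a 0 n (below-p (m<n+m a z<s)) (below-p (n≤1+n _)) ⟩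
      binom a n * binom 1 0          ≡⟨ cong (_* 1) (binom-vanish a n (m<n+m a z<s)) ⟩
      0                              ∎

  Attained : ℕ → Set
  Attained x = ∃[ M ] central M ≋ x

  data SmallProduct : ℕ → Set where
    empty : SmallProduct 1
    times : ∀ {x} c → 2 * c < p → SmallProduct x → SmallProduct (central c * x)

  small-central : ∀ c → 2 * c < p → SmallProduct (central c)
  small-central c 2c<p = subst SmallProduct (*-identityʳ (central c)) (times c 2c<p empty)

  small-* : ∀ {x y} → SmallProduct x → SmallProduct y → SmallProduct (x * y)
  small-* {y = y} empty            g = subst SmallProduct (sym (*-identityˡ y)) g
  small-* {y = y} (times {x} c h f) g =
    subst SmallProduct (sym (*-assoc (central c) x y)) (times c h (small-* f g))

  small-^ : ∀ {x} → SmallProduct x → ∀ k → SmallProduct (x ^ k)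
  small-^ g zero    = empty
  small-^ g (suc k) = small-* g (small-^ g k)

  attained-one : Attained 1
  attained-one = 0 , ≋-refl

  attained-resp : ∀ {x y} → x ≋ y → Attained x → Attained y
  attained-resp x≋y (M , e) = M , ≋-trans e x≋y

  -- Attained residues are closed under multiplication by small products:
  -- a small factor B(c) is placed in a new lowest p-adic digit.
  attained-scale : ∀ {x y} → SmallProduct y → Attained x → Attained (y * x)
  attained-scale {x} empty (M , e) = M , ≋-trans e (≋-reflexive (sym (*-identityˡ x)))
  attained-scale {x} (times {y} c h g) a =
    let M , e = attained-scale g a in
    c + M * p , (begin
      central (c + M * p)     ≈⟨ central-lucas c M h ⟩
      central c * central M   ≈⟨ *-≋ (≋-refl {central c}) e ⟩
      central c * (y * x)     ≡⟨ *-assoc (central c) y x ⟨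
      central c * y * x       ∎)
    where open ≋-Reasoning

  -- The odd step: 2j+1 ≡ B(j+1)·u^k·(j+1), where u = 2·B(j) and u·u^k ≡ 1,
  -- because (j+1)·B(j+1) = (2j+1)·u.
  odd-step : 2 < p → ∀ j → suc (2 * j) < p → Attained (suc j) → Attained (suc (2 * j))
  odd-step 2<p j m<p a =
    let k , u·uᵏ≋1 = power-inverse u-unit in
    attained-resp (m≋ k u·uᵏ≋1)
      (attained-scale (small-* (small-central (suc j) (odd-bound 2<p j m<p)) (small-^ u-small k)) a)
    where
    open ≋-Reasoning
    m = suc (2 * j)
    u = 2 * central j
    2j<p : 2 * j < p
    2j<p = <-trans (n<1+n _) m<p
    u-unit : p ∤ u
    u-unit = ∤-* (∤-small z<s 2<p) (central-unit j 2j<p)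
    u-small : SmallProduct u
    u-small = small-* (small-central 1 2<p) (small-central j 2j<p)
    m≋ : ∀ k → u * u ^ k ≋ 1 → central (suc j) * u ^ k * suc j ≋ m
    m≋ k u·uᵏ≋1 = begin
      central (suc j) * u ^ k * suc j  ≡⟨ rotate (central (suc j)) (u ^ k) (suc j) ⟩
      suc j * central (suc j) * u ^ k  ≡⟨ cong (_* u ^ k) (central-ratio j) ⟩
      m * u * u ^ k                    ≡⟨ *-assoc m u (u ^ k) ⟩
      m * (u * u ^ k)                  ≈⟨ *-≋ (≋-refl {m}) u·uᵏ≋1 ⟩
      m * 1                            ≡⟨ *-identityʳ m ⟩
      m                                ∎

  unit-attained : 2 < p → ∀ m → 0 < m → m < p → Attained m
  unit-attained 2<p = <-rec (λ m → 0 < m → m < p → Attained m) step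
    where
    half-below : ∀ j → suc j < 2 * suc j
    half-below j = m<m+n (suc j) z<s
    step : ∀ m → (∀ {k} → k < m → 0 < k → k < p → Attained k) → 0 < m → m < p → Attained m
    step m ih with evenOdd m
    ... | even zero    = λ ()
    ... | even (suc j) = λ _ m<p →
      attained-scale (small-central 1 2<p) (ih (half-below j) z<s (<-trans (half-below j) m<p))
    ... | odd zero     = λ _ _ → attained-one
    ... | odd (suc j)  = λ _ m<p →
      odd-step 2<p (suc j) m<p (ih (s≤s (half-below j)) z<s (<-trans (s≤s (half-below j)) m<p))

  catalan-surjective : 4 ≤ p → ∀ r → r < p → ∃[ n ] catalan n % p ≡ r
  catalan-surjective 4≤p zero _ =
    let a , 4+a≡p = m≤n⇒∃[o]m+o≡n 4≤p in
    2 + a , n∣m⇒m%n≡0 _ p (catalan-vanishes a (sym 4+a≡p))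
  catalan-surjective 4≤p r@(suc _) r<p =
    let M , e = unit-attained (≤-trans (n≤1+n 3) 4≤p) r z<s r<p in
    M * p , trans (same-residue (≋-trans (catalan-at-multiple M) e)) (m<n⇒m%n≡m r<p)

corollary1 : (p : ℕ) → .{{_ : NonZero p}} → Prime p → 5 ≤ p →
    (r : Fin p) → ∃[ n ] (catalan n % p ≡ toℕ r)
corollary1 (suc q) p-prime 5≤p r =
  CatalanModPrime.catalan-surjective q p-prime (≤-trans (n≤1+n 4) 5≤p) (toℕ r) (toℕ<n r)
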